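{- For any positive integers $r$ and $k$ with $2^{r-1}-1<2k<2^r-1$, the auxiliary number of $K(2k,k)$ equals $r$, and there exists an auxiliary set $\{V_1,\ldots,V_r\}$ for $K(2k,k)$ such that $\bigcap_{i=1}^r V_i=\emptyset$.
   Context: For positive integers $n\geq 2k$, let $P[n,k]$ denote the set of $k$-element subsets of $[n]=\{1,\ldots,n\}$. A family $\{V_1,\ldots,V_r\}\subseteq P[n,k]$ is called an auxiliary set for $K(n,k)$ if $\bigcup_{i=1}^r V_i=[n]$ and there is no pair of distinct elements $a,b\in[n]$ such that for each $i$ either $\{a,b\}\subseteq V_i$ or $\{a,b\}\subseteq [n]\setminus V_i$. The auxiliary number of $K(n,k)$ is the minimum cardinality of an auxiliary set for $K(n,k)$. -}

module Defs where

open import Data.Nat using (ℕ; _≤_)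
open import Data.Fin using (Fin)
open import Data.Fin.Subset using (Subset; _∈_; _∉_; ∣_∣)
open import Data.Product using (Σ; ∃; _×_)
open import Data.Sum using (_⊎_)
open import Function.Definitions using (Injective)
open import Relation.Binary.PropositionalEquality using (_≡_; _≢_)
open import Relation.Nullary using (¬_)

-- A family {V_1,…,V_r} of r distinct k-subsets of [n] = Fin n, indexed by Fin r.
-- Distinctness (injectivity) makes the family have cardinality exactly r.
record IsAuxiliarySet (n k r : ℕ) (V : Fin r → Subset n) : Set where
  field
    distinct  : Injective _≡_ _≡_ V
    kSubsets  : ∀ i → ∣ V i ∣ ≡ k
    covers    : ∀ (x : Fin n) → ∃ λ i → x ∈ V i
    separates : ∀ (a b : Fin n) → a ≢ b →
                ¬ (∀ i → (a ∈ V i × b ∈ V i) ⊎ (a ∉ V i × b ∉ V i))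

AuxiliaryNumber : ℕ → ℕ → ℕ → Set
AuxiliaryNumber n k m =
  (Σ (Fin m → Subset n) λ V → IsAuxiliarySet n k m V) ×
  (∀ (r : ℕ) (V : Fin r → Subset n) → IsAuxiliarySet n k r V → m ≤ r)

-- An auxiliary set V₁, …, V_m of K(n,k) gives each x ∈ [n] an incidence vector
-- (x ∈ V₁, …, x ∈ V_m) ∈ {0,1}^m; these vectors are pairwise distinct and nonzero,
-- so n < 2^m. For n = 2k ≥ 2^(r−1) this forces m ≥ r.
-- Conversely, as k < 2^(r−1), the j-th point of the first half of [2k] can be given
-- the vector (0, binary expansion of j) for j = 1, …, k, and the j-th point of the
-- second half the complementary vector. Each V_i then contains exactly one point of
-- each complementary pair, so has k elements; the vectors are distinct and neither
-- all-zero nor all-one, so the V_i cover [2k] and have empty intersection; and as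
-- k ≥ 2^(r−2), every unit vector is a binary expansion, which makes the V_i distinct.
module Submission where

open import Defs
open import Data.Nat using (ℕ; _+_; _*_; _∸_; _^_; _<_; _≤_)
open import Data.Fin using (Fin)
open import Data.Fin.Subset using (Subset; _∉_)
open import Data.Product using (Σ; ∃; _×_)

open import Data.Nat using (zero; suc; pred; >-nonZero)
open import Data.Bool using (Bool; true; false; not)
open import Data.Bool.Properties using (not-injective; ¬-not) renaming (_≟_ to _≟ᵇ_)
open import Data.Empty using (⊥-elim)
open import Data.Fin using (zero; suc; toℕ; fromℕ<; inject≤; combine; funToFin; finToFun; _≟_)
open import Data.Fin.Properties
  using (2↔Bool; funToFin-finToFin; finToFun-funToFin; toℕ-combine; combine-surjective;
         toℕ<n; toℕ-injective; toℕ-fromℕ<; toℕ-inject≤; inject≤-injective; suc-injective;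
         injective⇒≤; ¬∀⟶∃¬)
open import Data.Fin.Subset using (_∈_; ∁; ∣_∣; inside; outside)
open import Data.Fin.Subset.Properties using (∣∁p∣≡n∸∣p∣; ∣p∣≤n)
import Data.Nat.Properties as ℕ
open import Data.Product using (_,_; map₂)
open import Data.Sum using (_⊎_; inj₁; inj₂)
open import Data.Vec using ([]; _∷_; _++_; lookup; tabulate; concat)
open import Data.Vec.Properties using (lookup-concat; lookup-map; lookup∘tabulate; []=⇒lookup; lookup⇒[]=)
import Data.Vec.Functional as Vector
open import Function using (_∘_; Inverse)
open import Function.Definitions using (Injective)
open import Relation.Binary.PropositionalEquality
open import Relation.Nullary using (¬_; does; yes)
open import Relation.Nullary.Decidable using (dec-true; decidable-stable)

code : ∀ {m} → (Fin m → Bool) → Fin (2 ^ m)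
code f = funToFin (Inverse.from 2↔Bool ∘ f)

decode : ∀ {m} → Fin (2 ^ m) → Fin m → Bool
decode {m} c = Inverse.to 2↔Bool ∘ finToFun {2} {m} c

funToFin-cong : ∀ {m n} {f g : Fin m → Fin n} → f ≗ g → funToFin f ≡ funToFin g
funToFin-cong {zero}  f≗g = refl
funToFin-cong {suc m} f≗g = cong₂ combine (f≗g zero) (funToFin-cong (f≗g ∘ suc))

code-cong : ∀ {m} {f g : Fin m → Bool} → f ≗ g → code f ≡ code g
code-cong f≗g = funToFin-cong (cong (Inverse.from 2↔Bool) ∘ f≗g)

decode-code : ∀ {m} (f : Fin m → Bool) → decode (code f) ≗ f
decode-code f i = begin
  Inverse.to 2↔Bool (finToFun (funToFin (Inverse.from 2↔Bool ∘ f)) i)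
    ≡⟨ cong (Inverse.to 2↔Bool) (finToFun-funToFin {n = 2} (Inverse.from 2↔Bool ∘ f) i) ⟩
  Inverse.to 2↔Bool (Inverse.from 2↔Bool (f i))
    ≡⟨ Inverse.strictlyInverseˡ 2↔Bool (f i) ⟩
  f i ∎
  where open ≡-Reasoning

code-decode : ∀ {m} (c : Fin (2 ^ m)) → code (decode {m} c) ≡ c
code-decode {m} c = begin
  code (decode {m} c)
    ≡⟨ funToFin-cong (Inverse.strictlyInverseʳ 2↔Bool ∘ finToFun {2} {m} c) ⟩
  funToFin (finToFun {2} {m} c)
    ≡⟨ funToFin-finToFin {m} c ⟩
  c ∎
  where open ≡-Reasoning

code-injective : ∀ {m} → Injective _≗_ _≡_ (code {m})
code-injective {m} {f} {g} eq i = begin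
  f i                ≡⟨ decode-code f i ⟨
  decode (code f) i  ≡⟨ cong (λ c → decode {m} c i) eq ⟩
  decode (code g) i  ≡⟨ decode-code g i ⟩
  g i                ∎
  where open ≡-Reasoning

decode-injective : ∀ {m} → Injective _≡_ _≗_ (decode {m})
decode-injective {m} {c} {c′} eq = begin
  c                     ≡⟨ code-decode {m} c ⟨
  code (decode {m} c)   ≡⟨ code-cong {m} eq ⟩
  code (decode {m} c′)  ≡⟨ code-decode {m} c′ ⟩
  c′                    ∎
  where open ≡-Reasoning

toℕ-combine-zero : ∀ {n} (c : Fin n) → toℕ (combine {2} zero c) ≡ toℕ c
toℕ-combine-zero {n} c = trans (toℕ-combine {2} zero c) (cong (_+ toℕ c) (ℕ.*-zeroʳ n))

toℕ-code-false : ∀ m → toℕ (code {m} (λ _ → false)) ≡ 0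
toℕ-code-false zero    = refl
toℕ-code-false (suc m) = trans (toℕ-combine-zero (code {m} (λ _ → false))) (toℕ-code-false m)

false≢true : false ≢ true
false≢true ()

toℕ-code>0 : ∀ {m} (f : Fin m → Bool) {i} → f i ≡ true → 0 < toℕ (code f)
toℕ-code>0 {m} f {i} fi≡true = ℕ.n≢0⇒n>0 λ code≡0 → false≢true (trans (sym (f≗false code≡0 i)) fi≡true)
  where
  f≗false : toℕ (code f) ≡ 0 → f ≗ (λ _ → false)
  f≗false code≡0 = code-injective (toℕ-injective (trans code≡0 (sym (toℕ-code-false m))))

decode-nonzero : ∀ {m} (c : Fin (2 ^ m)) → toℕ c ≢ 0 → ∃ λ t → decode {m} c t ≡ true
decode-nonzero {m} c c≢0 = map₂ ¬-not (¬∀⟶∃¬ m _ (λ t → decode {m} c t ≟ᵇ false) (c≢0 ∘ toℕ≡0))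
  where
  open ≡-Reasoning
  toℕ≡0 : decode {m} c ≗ (λ _ → false) → toℕ c ≡ 0
  toℕ≡0 decode≗false = begin
    toℕ c                          ≡⟨ cong toℕ (code-decode {m} c) ⟨
    toℕ (code (decode {m} c))      ≡⟨ cong toℕ (code-cong {m} decode≗false) ⟩
    toℕ (code {m} (λ _ → false))   ≡⟨ toℕ-code-false m ⟩
    0                              ∎

unit : ∀ {m} → Fin m → Fin m → Bool
unit t t′ = does (t ≟ t′)

unit-diagonal : ∀ {m} (t : Fin m) → unit t t ≡ true
unit-diagonal t = dec-true (t ≟ t) refl

unit≡true⇒≡ : ∀ {m} {t t′ : Fin m} → unit t t′ ≡ true → t ≡ t′
unit≡true⇒≡ {t = t} {t′} eq with t ≟ t′
... | yes t≡t′ = t≡t′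

-- funToFin is big-endian: unit 0 codes 2^(s−1), every other unit vector has leading bit 0.
2*toℕ-code-unit≤2^ : ∀ {s} (t : Fin s) → 2 * toℕ (code (unit t)) ≤ 2 ^ s
2*toℕ-code-unit≤2^ {suc s} t = ℕ.*-monoʳ-≤ 2 (bound t)
  where
  open ≡-Reasoning
  bound : (t : Fin (suc s)) → toℕ (code (unit t)) ≤ 2 ^ s
  bound zero = ℕ.≤-reflexive (begin
    toℕ (combine {2} (suc zero) (code {s} (λ _ → false)))
      ≡⟨ toℕ-combine {2} (suc zero) (code {s} (λ _ → false)) ⟩
    2 ^ s * 1 + toℕ (code {s} (λ _ → false))
      ≡⟨ cong₂ _+_ (ℕ.*-identityʳ (2 ^ s)) (toℕ-code-false s) ⟩
    2 ^ s + 0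
      ≡⟨ ℕ.+-identityʳ (2 ^ s) ⟩
    2 ^ s ∎)
  bound (suc u) = ℕ.<⇒≤ (subst (_< 2 ^ s) (sym (toℕ-combine-zero {2 ^ s} rest)) (toℕ<n rest))
    where
    rest : Fin (2 ^ s)
    rest = code (unit (suc u) ∘ suc)

incidence : ∀ {n r} → (Fin r → Subset n) → Fin n → Fin r → Bool
incidence V x i = lookup (V i) x

SameSide : ∀ {n} → Fin n → Fin n → Subset n → Set
SameSide a b p = (a ∈ p × b ∈ p) ⊎ (a ∉ p × b ∉ p)

∉⇒lookup≡false : ∀ {n} {p : Subset n} {x} → x ∉ p → lookup p x ≡ false
∉⇒lookup≡false {p = p} {x} x∉p = ¬-not (x∉p ∘ lookup⇒[]= x p)

lookup≡false⇒∉ : ∀ {n} {p : Subset n} {x} → lookup p x ≡ false → x ∉ p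
lookup≡false⇒∉ eq = false≢true ∘ trans (sym eq) ∘ []=⇒lookup

sameSide⇒lookup≡ : ∀ {n} {p : Subset n} {a b} → SameSide a b p → lookup p a ≡ lookup p b
sameSide⇒lookup≡ (inj₁ (a∈p , b∈p)) = trans ([]=⇒lookup a∈p) (sym ([]=⇒lookup b∈p))
sameSide⇒lookup≡ (inj₂ (a∉p , b∉p)) = trans (∉⇒lookup≡false a∉p) (sym (∉⇒lookup≡false b∉p))

lookup≡⇒sameSide : ∀ {n} {p : Subset n} {a b} → lookup p a ≡ lookup p b → SameSide a b p
lookup≡⇒sameSide {p = p} {a} {b} eq with lookup p a in pa
... | true  = inj₁ (lookup⇒[]= a p pa , lookup⇒[]= b p (sym eq))
... | false = inj₂ (lookup≡false⇒∉ pa , lookup≡false⇒∉ (sym eq))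

module _ {n r} (V : Fin r → Subset n) where

  separates⇒incidence-injective :
    (∀ a b → a ≢ b → ¬ (∀ i → SameSide a b (V i))) → Injective _≡_ _≗_ (incidence V)
  separates⇒incidence-injective separates {a} {b} eq =
    decidable-stable (a ≟ b) λ a≢b → separates a b a≢b (lookup≡⇒sameSide ∘ eq)

  incidence-injective⇒separates :
    Injective _≡_ _≗_ (incidence V) → ∀ a b → a ≢ b → ¬ (∀ i → SameSide a b (V i))
  incidence-injective⇒separates injective a b a≢b same = a≢b (injective (sameSide⇒lookup≡ ∘ same))

-- The extra point 0 is sent to the all-false code, which no f x can take.
injective-nonzero⇒<2^ : ∀ {n m} (f : Fin n → Fin m → Bool) → Injective _≡_ _≗_ f →
                        (∀ x → ∃ λ i → f x i ≡ true) → n < 2 ^ m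
injective-nonzero⇒<2^ {n} {m} f f-injective nonzero = injective⇒≤ g-injective
  where
  g : Fin (suc n) → Fin (2 ^ m)
  g zero    = code {m} (λ _ → false)
  g (suc x) = code (f x)

  code-false≢ : ∀ x → code {m} (λ _ → false) ≢ code (f x)
  code-false≢ x eq with nonzero x
  ... | i , fxi≡true = false≢true (trans (code-injective eq i) fxi≡true)

  g-injective : Injective _≡_ _≡_ g
  g-injective {zero}  {zero}  _  = refl
  g-injective {zero}  {suc y} eq = ⊥-elim (code-false≢ y eq)
  g-injective {suc x} {zero}  eq = ⊥-elim (code-false≢ x (sym eq))
  g-injective {suc x} {suc y} eq = cong suc (f-injective (code-injective eq))

auxiliarySet⇒<2^ : ∀ {n k r} {V : Fin r → Subset n} → IsAuxiliarySet n k r V → n < 2 ^ r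
auxiliarySet⇒<2^ {V = V} aux =
  injective-nonzero⇒<2^ (incidence V) (separates⇒incidence-injective V separates)
    (map₂ []=⇒lookup ∘ covers)
  where open IsAuxiliarySet aux

2^m<2^n⇒m<n : ∀ {m n} → 2 ^ m < 2 ^ n → m < n
2^m<2^n⇒m<n 2^m<2^n = ℕ.≰⇒> λ n≤m → ℕ.<⇒≱ 2^m<2^n (ℕ.^-monoʳ-≤ 2 n≤m)

∣p++q∣≡∣p∣+∣q∣ : ∀ {m n} (p : Subset m) (q : Subset n) → ∣ p ++ q ∣ ≡ ∣ p ∣ + ∣ q ∣
∣p++q∣≡∣p∣+∣q∣ []            q = refl
∣p++q∣≡∣p∣+∣q∣ (inside  ∷ p) q = cong suc (∣p++q∣≡∣p∣+∣q∣ p q)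
∣p++q∣≡∣p∣+∣q∣ (outside ∷ p) q = ∣p++q∣≡∣p∣+∣q∣ p q

∣p++∁p∣≡n : ∀ {n} (p : Subset n) → ∣ p ++ (∁ p ++ []) ∣ ≡ n
∣p++∁p∣≡n {n} p = begin
  ∣ p ++ (∁ p ++ []) ∣      ≡⟨ ∣p++q∣≡∣p∣+∣q∣ p (∁ p ++ []) ⟩
  ∣ p ∣ + ∣ ∁ p ++ [] ∣     ≡⟨ cong (∣ p ∣ +_) (∣p++q∣≡∣p∣+∣q∣ (∁ p) []) ⟩
  ∣ p ∣ + (∣ ∁ p ∣ + 0)     ≡⟨ cong (∣ p ∣ +_) (ℕ.+-identityʳ ∣ ∁ p ∣) ⟩
  ∣ p ∣ + ∣ ∁ p ∣           ≡⟨ cong (∣ p ∣ +_) (∣∁p∣≡n∸∣p∣ p) ⟩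
  ∣ p ∣ + (n ∸ ∣ p ∣)       ≡⟨ ℕ.m+[n∸m]≡n (∣p∣≤n p) ⟩
  n                         ∎
  where open ≡-Reasoning

module Doubling {k s : ℕ} (row : Fin k → Fin s → Bool) where

  leftRow : Fin k → Fin (suc s) → Bool
  leftRow j = false Vector.∷ row j

  column : Fin (suc s) → Subset k
  column i = tabulate (λ j → leftRow j i)

  family : Fin (suc s) → Subset (2 * k)
  family i = concat (column i ∷ ∁ (column i) ∷ [])

  leftPoint rightPoint : Fin k → Fin (2 * k)
  leftPoint  = combine {2} zero
  rightPoint = combine {2} (suc zero)

  lookup-left : ∀ i j → lookup (family i) (leftPoint j) ≡ leftRow j i
  lookup-left i j = trans (lookup-concat (column i ∷ ∁ (column i) ∷ []) zero j) (lookup∘tabulate _ j)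

  lookup-right : ∀ i j → lookup (family i) (rightPoint j) ≡ not (leftRow j i)
  lookup-right i j = begin
    lookup (family i) (rightPoint j) ≡⟨ lookup-concat (column i ∷ ∁ (column i) ∷ []) (suc zero) j ⟩
    lookup (∁ (column i)) j          ≡⟨ lookup-map j not (column i) ⟩
    not (lookup (column i) j)        ≡⟨ cong not (lookup∘tabulate _ j) ⟩
    not (leftRow j i)                ∎
    where open ≡-Reasoning

  data Half : Fin (2 * k) → Set where
    left  : ∀ j → Half (leftPoint j)
    right : ∀ j → Half (rightPoint j)

  half : ∀ x → Half x
  half x with combine-surjective {2} {k} x
  ... | zero     , j , refl = left j
  ... | suc zero , j , refl = right j

  ∣family∣≡k : ∀ i → ∣ family i ∣ ≡ k
  ∣family∣≡k i = ∣p++∁p∣≡n (column i)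

  family-injective : Injective _≡_ _≗_ (λ i j → leftRow j i) → Injective _≡_ _≡_ family
  family-injective columns-injective {i} {i′} eq = columns-injective λ j → begin
    leftRow j i                      ≡⟨ lookup-left i j ⟨
    lookup (family i)  (leftPoint j) ≡⟨ cong (λ p → lookup p (leftPoint j)) eq ⟩
    lookup (family i′) (leftPoint j) ≡⟨ lookup-left i′ j ⟩
    leftRow j i′                     ∎
    where open ≡-Reasoning

  units⇒columns-injective : (∀ t → ∃ λ j → row j ≗ unit t) → Injective _≡_ _≗_ (λ i j → leftRow j i)
  units⇒columns-injective units {zero}  {zero}   _  = refl
  units⇒columns-injective units {zero}  {suc t}  eq with units t
  ... | j , rowj≗unit = ⊥-elim (false≢true (trans (eq j) (trans (rowj≗unit t) (unit-diagonal t))))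
  units⇒columns-injective units {suc t} {zero}   eq with units t
  ... | j , rowj≗unit = ⊥-elim (false≢true (trans (sym (eq j)) (trans (rowj≗unit t) (unit-diagonal t))))
  units⇒columns-injective units {suc t} {suc t′} eq with units t
  ... | j , rowj≗unit = cong suc (unit≡true⇒≡ (begin
    unit t t′ ≡⟨ rowj≗unit t′ ⟨
    row j t′  ≡⟨ eq j ⟨
    row j t   ≡⟨ rowj≗unit t ⟩
    unit t t  ≡⟨ unit-diagonal t ⟩
    true      ∎))
    where open ≡-Reasoning

  halves-separated : ∀ j j′ → lookup (family zero) (leftPoint j) ≢ lookup (family zero) (rightPoint j′)
  halves-separated j j′ eq = false≢true (trans (sym (lookup-left zero j)) (trans eq (lookup-right zero j′)))

  incidence-injective : Injective _≡_ _≗_ row → Injective _≡_ _≗_ (incidence family)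
  incidence-injective row-injective {x} {y} eq with half x | half y
  ... | left j  | left j′  = cong leftPoint (row-injective λ t →
    trans (sym (lookup-left (suc t) j)) (trans (eq (suc t)) (lookup-left (suc t) j′)))
  ... | left j  | right j′ = ⊥-elim (halves-separated j j′ (eq zero))
  ... | right j | left j′  = ⊥-elim (halves-separated j′ j (sym (eq zero)))
  ... | right j | right j′ = cong rightPoint (row-injective λ t → not-injective
    (trans (sym (lookup-right (suc t) j)) (trans (eq (suc t)) (lookup-right (suc t) j′))))

  covers : (∀ j → ∃ λ t → row j t ≡ true) → ∀ x → ∃ λ i → x ∈ family i
  covers nonzero x with half x
  ... | left j with nonzero j
  ...   | t , rowjt≡true = suc t , lookup⇒[]= _ (family (suc t)) (trans (lookup-left (suc t) j) rowjt≡true)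
  covers nonzero x | right j = zero , lookup⇒[]= _ (family zero) (lookup-right zero j)

  avoids : (∀ j → ∃ λ t → row j t ≡ true) → ∀ x → ∃ λ i → x ∉ family i
  avoids nonzero x with half x
  ... | left j = zero , lookup≡false⇒∉ (lookup-left zero j)
  ... | right j with nonzero j
  ...   | t , rowjt≡true = suc t , lookup≡false⇒∉ (trans (lookup-right (suc t) j) (cong not rowjt≡true))

  isAuxiliarySet : Injective _≡_ _≗_ row → (∀ j → ∃ λ t → row j t ≡ true) →
                   (∀ t → ∃ λ j → row j ≗ unit t) → IsAuxiliarySet (2 * k) k (suc s) family
  isAuxiliarySet row-injective nonzero units = record
    { distinct  = family-injective (units⇒columns-injective units)
    ; kSubsets  = ∣family∣≡k
    ; covers    = covers nonzero
    ; separates = incidence-injective⇒separates family (incidence-injective row-injective)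
    }

module BinaryTable {k s : ℕ} (k<2^s : k < 2 ^ s) where

  number : Fin k → Fin (2 ^ s)
  number j = inject≤ (suc j) k<2^s

  row : Fin k → Fin s → Bool
  row j = decode {s} (number j)

  row-injective : Injective _≡_ _≗_ row
  row-injective eq = suc-injective (inject≤-injective _ _ _ _ (decode-injective eq))

  row-nonzero : ∀ j → ∃ λ t → row j t ≡ true
  row-nonzero j = decode-nonzero (number j) λ eq → ℕ.0≢1+n (trans (sym eq) (toℕ-inject≤ (suc j) k<2^s))

  number-onto : (c : Fin (2 ^ s)) → 0 < toℕ c → toℕ c ≤ k → ∃ λ j → number j ≡ c
  number-onto c c>0 c≤k = fromℕ< pred[c]<k , toℕ-injective (begin
    toℕ (number (fromℕ< pred[c]<k)) ≡⟨ toℕ-inject≤ (suc (fromℕ< pred[c]<k)) k<2^s ⟩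
    suc (toℕ (fromℕ< pred[c]<k))    ≡⟨ cong suc (toℕ-fromℕ< pred[c]<k) ⟩
    suc (pred (toℕ c))              ≡⟨ suc-pred[c] ⟩
    toℕ c                           ∎)
    where
    open ≡-Reasoning
    suc-pred[c] : suc (pred (toℕ c)) ≡ toℕ c
    suc-pred[c] = ℕ.suc-pred (toℕ c) {{>-nonZero c>0}}
    pred[c]<k : pred (toℕ c) < k
    pred[c]<k = subst (_≤ k) (sym suc-pred[c]) c≤k

  row-units : 2 ^ s ≤ 2 * k → ∀ t → ∃ λ j → row j ≗ unit t
  row-units 2^s≤2k t with number-onto (code (unit t)) (toℕ-code>0 (unit t) (unit-diagonal t))
                            (ℕ.*-cancelˡ-≤ 2 (ℕ.≤-trans (2*toℕ-code-unit≤2^ t) 2^s≤2k))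
  ... | j , number≡code = j , λ t′ →
    trans (cong (λ c → decode {s} c t′) number≡code) (decode-code (unit t) t′)

mainTheorem5 : ∀ (r k : ℕ) → 1 ≤ r → 1 ≤ k →
    2 ^ (r ∸ 1) ∸ 1 < 2 * k → 2 * k < 2 ^ r ∸ 1 →
    AuxiliaryNumber (2 * k) k r ×
    Σ (Fin r → Subset (2 * k)) (λ V → IsAuxiliarySet (2 * k) k r V × (∀ (x : Fin (2 * k)) → ∃ λ i → x ∉ V i))
mainTheorem5 zero    _ () _ _ _
mainTheorem5 (suc s) k _  _ lower upper =
  ((family , auxiliary) , minimal) , family , auxiliary , avoids row-nonzero
  where
  2^s≤2k : 2 ^ s ≤ 2 * k
  2^s≤2k = subst (_≤ 2 * k) (ℕ.suc-pred (2 ^ s) {{ℕ.m^n≢0 2 s}}) lower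

  k<2^s : k < 2 ^ s
  k<2^s = ℕ.*-cancelˡ-< 2 k (2 ^ s) (ℕ.<-≤-trans upper (ℕ.m∸n≤m _ 1))

  open BinaryTable {k} {s} k<2^s
  open Doubling row

  auxiliary : IsAuxiliarySet (2 * k) k (suc s) family
  auxiliary = isAuxiliarySet row-injective row-nonzero (row-units 2^s≤2k)

  minimal : ∀ r (V : Fin r → Subset (2 * k)) → IsAuxiliarySet (2 * k) k r V → suc s ≤ r
  minimal r V aux = 2^m<2^n⇒m<n (ℕ.≤-<-trans 2^s≤2k (auxiliarySet⇒<2^ aux))
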